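{- For every $n\ge 4$, let $W(n)$ be the maximum of $W(G)$ over all graphs $G$ with $n$ vertices and $\chi(G)>3$. Then $W(n)\le\frac34 n+1$.
   Context: Graphs are finite and simple; $\chi(G)$ is the chromatic number and $K_3$ the complete graph on 3 vertices. Graphs are viewed as structures in the first-order language with adjacency and equality. An existential-positive first-order formula is one built using only conjunction, disjunction and existential quantification; its width is the number of distinct variables in it. For $G$ with $\chi(G)>3$, $W(G)$ is the minimum $k$ such that some existential-positive sentence of width at most $k$ is true on $G$ and false on $K_3$. -}

module Defs where

open import Data.Nat using (ℕ; _≟_)
open import Data.Fin using (Fin)
import Data.Fin as F
open import Data.Bool using (Bool; true; false; if_then_else_; not)
open import Data.List using (List; []; _∷_; _++_; length; deduplicate; filterᵇ)
open import Data.Product using (Σ; _×_)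
open import Data.Sum using (_⊎_)
open import Relation.Nullary using (¬_)
open import Relation.Nullary.Decidable using (⌊_⌋)
open import Relation.Binary.PropositionalEquality using (_≡_)

record Graph (n : ℕ) : Set where
  field
    adj   : Fin n → Fin n → Bool
    sym   : ∀ i j → adj i j ≡ adj j i
    irrefl : ∀ i → adj i i ≡ false
open Graph public

K3 : Graph 3
K3 = record
  { adj = λ i j → not ⌊ i F.≟ j ⌋
  ; sym = symK
  ; irrefl = irrK
  }
  where
  open import Relation.Binary.PropositionalEquality using (refl)
  symK : ∀ (i j : Fin 3) → not ⌊ i F.≟ j ⌋ ≡ not ⌊ j F.≟ i ⌋
  symK F.zero F.zero = refl
  symK F.zero (F.suc F.zero) = refl
  symK F.zero (F.suc (F.suc F.zero)) = refl
  symK (F.suc F.zero) F.zero = refl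
  symK (F.suc F.zero) (F.suc F.zero) = refl
  symK (F.suc F.zero) (F.suc (F.suc F.zero)) = refl
  symK (F.suc (F.suc F.zero)) F.zero = refl
  symK (F.suc (F.suc F.zero)) (F.suc F.zero) = refl
  symK (F.suc (F.suc F.zero)) (F.suc (F.suc F.zero)) = refl
  irrK : ∀ (i : Fin 3) → not ⌊ i F.≟ i ⌋ ≡ false
  irrK F.zero = refl
  irrK (F.suc F.zero) = refl
  irrK (F.suc (F.suc F.zero)) = refl

ProperColouring : ∀ {n} → Graph n → (k : ℕ) → (Fin n → Fin k) → Set
ProperColouring G k c = ∀ i j → adj G i j ≡ true → ¬ (c i ≡ c j)

χ>_ : ∀ {n} → ℕ → Graph n → Set
(χ> k) G = ¬ (Σ (Fin _ → Fin k) λ c → ProperColouring G k c)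

-- Existential-positive first-order formulas over the language {E, =},
-- with variables named by natural numbers.
Var : Set
Var = ℕ

data EPFormula : Set where
  edge : Var → Var → EPFormula
  eq   : Var → Var → EPFormula
  _∧_  : EPFormula → EPFormula → EPFormula
  _∨_  : EPFormula → EPFormula → EPFormula
  ∃′   : Var → EPFormula → EPFormula

vars : EPFormula → List Var
vars (edge x y) = x ∷ y ∷ []
vars (eq x y)   = x ∷ y ∷ []
vars (φ ∧ ψ)    = vars φ ++ vars ψ
vars (φ ∨ ψ)    = vars φ ++ vars ψ
vars (∃′ x φ)   = x ∷ vars φ

width : EPFormula → ℕ
width φ = length (deduplicate _≟_ (vars φ))

fv : EPFormula → List Var
fv (edge x y) = x ∷ y ∷ []
fv (eq x y)   = x ∷ y ∷ []
fv (φ ∧ ψ)    = fv φ ++ fv ψ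
fv (φ ∨ ψ)    = fv φ ++ fv ψ
fv (∃′ x φ)   = filterᵇ (λ y → not ⌊ y ≟ x ⌋) (fv φ)

IsSentence : EPFormula → Set
IsSentence φ = fv φ ≡ []

_[_↦_] : ∀ {n} → (Var → Fin n) → Var → Fin n → (Var → Fin n)
(ρ [ x ↦ v ]) y = if ⌊ y ≟ x ⌋ then v else ρ y

Sat : ∀ {n} → Graph n → (Var → Fin n) → EPFormula → Set
Sat G ρ (edge x y) = adj G (ρ x) (ρ y) ≡ true
Sat G ρ (eq x y)   = ρ x ≡ ρ y
Sat G ρ (φ ∧ ψ)    = Sat G ρ φ × Sat G ρ ψ
Sat G ρ (φ ∨ ψ)    = Sat G ρ φ ⊎ Sat G ρ ψ
Sat G ρ (∃′ x φ)   = Σ (Fin _) λ v → Sat G (ρ [ x ↦ v ]) φ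

-- Truth of a sentence in a graph (for sentences, independent of the
-- assignment; we quantify over all assignments).
_⊨_ : ∀ {n} → Graph n → EPFormula → Set
G ⊨ φ = ∀ (ρ : Var → Fin _) → Sat G ρ φ

-- W(G) ≤ k : some existential-positive sentence of width ≤ k is true on G
-- and false on K₃.
W≤ : ∀ {n} → Graph n → ℕ → Set
W≤ G k = Σ EPFormula λ φ → IsSentence φ × (width φ Data.Nat.≤ k) × (G ⊨ φ) × ¬ (K3 ⊨ φ)

-- Colour the vertices one at a time. Suppose c properly 3-colours G on a
-- set L of vertices and v is a new vertex; let B be a largest colour class
-- of c in L and S = (L ∖ B) ∪ {v}. The sentence φ asserting that there are
-- x_s (s ∈ S) spanning a homomorphic image of G[S], and that for every
-- u ∈ B some vertex is adjacent to all x_s with s ~ u, needs only |S| + 1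
-- variables, because the vertices of B all reuse one variable. G satisfies
-- φ. If K₃ satisfies φ, the witnesses 3-colour G on L ∪ {v}: each u ∈ B
-- takes the colour of its own witness, which is safe as B is independent.
-- So either the colouring extends or φ shows W(G) ≤ |S| + 1, and
-- |S| ≤ 1 + 2(n − 1)/3 gives |S| + 1 ≤ 3n/4 + 1 once n ≥ 4. As χ(G) > 3,
-- the colouring cannot be extended to all vertices of G.
module Submission where

open import Defs
open import Data.Nat as ℕ using (ℕ; zero; suc; _≤_; _<_; _*_; _+_; s≤s)
import Data.Nat.Properties as ℕₚ
open import Data.Nat.Tactic.RingSolver using (solve-∀)
open import Data.Fin as Fin using (Fin; toℕ; fromℕ<)
open import Data.Fin.Patterns using (0F; 1F; 2F)
import Data.Fin.Properties as Finₚ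
open import Data.Bool as Bool using (Bool; true; false; not; T; T?)
open import Data.List using (List; []; _∷_; length; map; filter; allFin)
import Data.List.Properties as Listₚ
open import Data.List.Extrema ℕₚ.≤-totalOrder using (argmax; f[⊥]≤f[argmax]; f[xs]≤f[argmax])
open import Data.List.Membership.Propositional using (_∈_; _∉_)
open import Data.List.Membership.Propositional.Properties using (∈-map⁺; ∈-filter⁺; ∈-filter⁻; ∈-allFin)
import Data.List.Membership.DecPropositional as DecMembership
open import Data.List.Relation.Unary.Any as Any using (Any; here; there)
open import Data.List.Relation.Unary.All as All using (All; []; _∷_)
import Data.List.Relation.Unary.All.Properties as Allₚ
open import Data.List.Relation.Unary.Unique.Propositional using (Unique)
open import Data.List.Relation.Unary.AllPairs using ([]; _∷_)
open import Data.List.Relation.Unary.Unique.DecPropositional.Properties using (deduplicate-!)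
open import Data.Product using (Σ; _×_; _,_; proj₁; proj₂)
open import Data.Sum as Sum using (_⊎_; inj₁; inj₂; [_,_])
open import Data.Empty using (⊥; ⊥-elim)
open import Function using (_∘_)
open import Relation.Nullary using (¬_; Dec; yes; no; ¬?)
open import Relation.Nullary.Decidable using (⌊_⌋; _×-dec_; _⊎-dec_)
open import Relation.Unary using (Pred; Decidable)
open import Relation.Binary.Definitions using (DecidableEquality)
open import Relation.Binary.PropositionalEquality as ≡ using (_≡_; _≢_; refl; trans; cong; subst; subst₂)

length-filter-split : ∀ {a p} {A : Set a} {P : Pred A p} (P? : Decidable P) xs →
                      length (filter P? xs) + length (filter (¬? ∘ P?) xs) ≡ length xs
length-filter-split P? [] = refl
length-filter-split P? (x ∷ xs) with P? x
... | yes _ = cong suc (length-filter-split P? xs)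
... | no _  = trans (ℕₚ.+-suc _ _) (cong suc (length-filter-split P? xs))

module _ {a} {A : Set a} (_≟_ : DecidableEquality A) where

  Unique⇒length≤ : ∀ {xs ys : List A} → Unique xs → All (_∈ ys) xs → length xs ≤ length ys
  Unique⇒length≤ {[]} _ _ = ℕ.z≤n
  Unique⇒length≤ {x ∷ xs} {ys} (x∉xs ∷ !xs) (x∈ys ∷ xs⊆ys) =
    ℕₚ.≤-trans (s≤s (Unique⇒length≤ !xs xs⊆ys∖x)) (Listₚ.filter-notAll (¬? ∘ (_≟ x)) ys ¬¬x∈ys)
    where
    ¬¬x∈ys : Any (λ z → ¬ ¬ z ≡ x) ys
    ¬¬x∈ys = Any.map (λ { refl z≢z → z≢z refl }) x∈ys
    xs⊆ys∖x : All (_∈ filter (¬? ∘ (_≟ x)) ys) xs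
    xs⊆ys∖x = All.zipWith (λ { (x≢z , z∈ys) → ∈-filter⁺ (¬? ∘ (_≟ x)) z∈ys (x≢z ∘ ≡.sym) }) (x∉xs , xs⊆ys)

All⊥⇒[] : ∀ {a} {A : Set a} {xs : List A} → All (λ _ → ⊥) xs → xs ≡ []
All⊥⇒[] [] = refl

module _ {A : Set} (c : A → Fin 3) where

  hasColour? : ∀ k → Decidable (λ x → c x ≡ k)
  hasColour? k x = c x Fin.≟ k

  classSize : Fin 3 → List A → ℕ
  classSize k L = length (filter (hasColour? k) L)

  classSizes-sum : ∀ L → classSize 0F L + classSize 1F L + classSize 2F L ≡ length L
  classSizes-sum []      = refl
  classSizes-sum (x ∷ L) with c x
  ... | 0F = cong suc (classSizes-sum L)
  ... | 1F = trans (cong (_+ classSize 2F L) (ℕₚ.+-suc (classSize 0F L) _)) (cong suc (classSizes-sum L))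
  ... | 2F = trans (ℕₚ.+-suc _ _) (cong suc (classSizes-sum L))

  largest-class : ∀ L → Σ (Fin 3) λ b → length (filter (¬? ∘ hasColour? b) L) ≤ 2 * classSize b L
  largest-class L = b , ℕₚ.+-cancelˡ-≤ (size b) _ _ (begin
    size b + length (filter (¬? ∘ hasColour? b) L) ≡⟨ length-filter-split (hasColour? b) L ⟩
    length L                                      ≡⟨ classSizes-sum L ⟨
    size 0F + size 1F + size 2F                   ≤⟨ ℕₚ.+-mono-≤ (ℕₚ.+-mono-≤ size₀≤ size₁≤) size₂≤ ⟩
    size b + size b + size b                      ≡⟨ ℕₚ.+-assoc (size b) _ _ ⟩
    size b + (size b + size b)                    ≡⟨ cong (λ t → size b + (size b + t)) (ℕₚ.+-identityʳ _) ⟨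
    size b + 2 * size b                           ∎)
    where
    open ℕₚ.≤-Reasoning
    size : Fin 3 → ℕ
    size k = classSize k L
    b : Fin 3
    b = argmax size 0F (1F ∷ 2F ∷ [])
    size₀≤ : size 0F ≤ size b
    size₀≤ = f[⊥]≤f[argmax] {f = size} 0F (1F ∷ 2F ∷ [])
    size₁≤ : size 1F ≤ size b
    size₁≤ = All.head (f[xs]≤f[argmax] {f = size} 0F (1F ∷ 2F ∷ []))
    size₂≤ : size 2F ≤ size b
    size₂≤ = All.lookup (f[xs]≤f[argmax] {f = size} 0F (1F ∷ 2F ∷ [])) (there (here refl))

width-budget : ∀ {a s n} → s ≤ 2 * a → a + s < n → 4 ≤ n → 4 * (2 + s) ≤ 3 * n + 4
width-budget {zero} {zero} {n} _ _ 4≤n = ℕₚ.≤-trans (ℕₚ.m≤m+n 8 8) (ℕₚ.+-monoˡ-≤ 4 (ℕₚ.*-monoʳ-≤ 3 4≤n))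
width-budget {suc a} {s} {n} s≤2a a+s<n _ = begin
  4 * (2 + s)             ≡⟨ 4*[2+s]≡1+s+[3s+7] s ⟩
  suc s + (3 * s + 7)     ≤⟨ ℕₚ.+-monoˡ-≤ (3 * s + 7) 1+s≤3a ⟩
  3 * suc a + (3 * s + 7) ≡⟨ 3*[1+a]+[3s+7]≡3*[2+a+s]+4 a s ⟩
  3 * suc (suc a + s) + 4 ≤⟨ ℕₚ.+-monoˡ-≤ 4 (ℕₚ.*-monoʳ-≤ 3 a+s<n) ⟩
  3 * n + 4               ∎
  where
  open ℕₚ.≤-Reasoning
  4*[2+s]≡1+s+[3s+7] : ∀ s → 4 * (2 + s) ≡ suc s + (3 * s + 7)
  4*[2+s]≡1+s+[3s+7] = solve-∀
  3*[1+a]+[3s+7]≡3*[2+a+s]+4 : ∀ a s → 3 * suc a + (3 * s + 7) ≡ 3 * suc (suc a + s) + 4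
  3*[1+a]+[3s+7]≡3*[2+a+s]+4 = solve-∀
  1+s≤3a : suc s ≤ 3 * suc a
  1+s≤3a = s≤s (ℕₚ.≤-trans s≤2a (ℕₚ.m≤n+m _ a))

-- The language has no truth constant; ⊤ᶠ reuses the reserved variable 0 so
-- that it never increases the width.
⊤ᶠ : EPFormula
⊤ᶠ = ∃′ 0 (eq 0 0)

⋀ : {A : Set} → List A → (A → EPFormula) → EPFormula
⋀ []       f = ⊤ᶠ
⋀ (x ∷ xs) f = f x ∧ ⋀ xs f

∃⋆ : List Var → EPFormula → EPFormula
∃⋆ []       ψ = ψ
∃⋆ (x ∷ xs) ψ = ∃′ x (∃⋆ xs ψ)

edgeIf : Bool → Var → Var → EPFormula
edgeIf true  x y = edge x y
edgeIf false x y = ⊤ᶠ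

module _ {P : Var → Set} where

  fv-⋀ : {A : Set} (xs : List A) {f : A → EPFormula} →
         (∀ {x} → x ∈ xs → All P (fv (f x))) → All P (fv (⋀ xs f))
  fv-⋀ []       h = []
  fv-⋀ (x ∷ xs) h = Allₚ.++⁺ (h (here refl)) (fv-⋀ xs (h ∘ there))

  fv-edgeIf : ∀ b {x y} → P x → P y → All P (fv (edgeIf b x y))
  fv-edgeIf true  px py = px ∷ py ∷ []
  fv-edgeIf false px py = []

  fv-∃′ : ∀ x φ → All (λ z → z ≡ x ⊎ P z) (fv φ) → All P (fv (∃′ x φ))
  fv-∃′ x φ h = All.zipWith drop-x (Allₚ.all-filter keep? (fv φ) , Allₚ.filter⁺ keep? h)
    where
    keep? : Decidable (λ y → T (not ⌊ y ℕ.≟ x ⌋))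
    keep? y = T? (not ⌊ y ℕ.≟ x ⌋)
    drop-x : ∀ {z} → T (not ⌊ z ℕ.≟ x ⌋) × (z ≡ x ⊎ P z) → P z
    drop-x (_ , inj₂ pz) = pz
    drop-x {z} (kept , inj₁ refl) with z ℕ.≟ z
    ... | yes _ = ⊥-elim kept
    ... | no z≢z = ⊥-elim (z≢z refl)

fv-∃⋆ : ∀ {P : Var → Set} xs ψ → All (λ z → z ∈ xs ⊎ P z) (fv ψ) → All P (fv (∃⋆ xs ψ))
fv-∃⋆     []       ψ h = All.map (λ { (inj₂ pz) → pz }) h
fv-∃⋆ {P} (x ∷ xs) ψ h = fv-∃′ x (∃⋆ xs ψ) (fv-∃⋆ xs ψ (All.map shift h))
  where
  shift : ∀ {z} → z ∈ x ∷ xs ⊎ P z → z ∈ xs ⊎ (z ≡ x ⊎ P z)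
  shift (inj₁ (here z≡x))   = inj₂ (inj₁ z≡x)
  shift (inj₁ (there z∈xs)) = inj₁ z∈xs
  shift (inj₂ pz)           = inj₂ (inj₂ pz)

module _ {P : Var → Set} (p0 : P 0) where

  vars-⋀ : {A : Set} (xs : List A) {f : A → EPFormula} →
           (∀ {x} → x ∈ xs → All P (vars (f x))) → All P (vars (⋀ xs f))
  vars-⋀ []       h = p0 ∷ p0 ∷ p0 ∷ []
  vars-⋀ (x ∷ xs) h = Allₚ.++⁺ (h (here refl)) (vars-⋀ xs (h ∘ there))

  vars-edgeIf : ∀ b {x y} → P x → P y → All P (vars (edgeIf b x y))
  vars-edgeIf true  px py = px ∷ py ∷ []
  vars-edgeIf false px py = p0 ∷ p0 ∷ p0 ∷ []

vars-∃⋆ : ∀ {P : Var → Set} xs ψ → All P xs → All P (vars ψ) → All P (vars (∃⋆ xs ψ))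
vars-∃⋆ []       ψ []         h = h
vars-∃⋆ (x ∷ xs) ψ (px ∷ pxs) h = px ∷ vars-∃⋆ xs ψ pxs h

width≤length : ∀ φ {ys : List Var} → All (_∈ ys) (vars φ) → width φ ≤ length ys
width≤length φ h = Unique⇒length≤ ℕ._≟_ (deduplicate-! ℕ._≟_ (vars φ)) (Allₚ.deduplicate⁺ ℕ._≟_ h)

_[_↦⋆_] : ∀ {n} → (Var → Fin n) → List Var → (Var → Fin n) → (Var → Fin n)
ρ [ []     ↦⋆ f ] = ρ
ρ [ x ∷ xs ↦⋆ f ] = (ρ [ x ↦ f x ]) [ xs ↦⋆ f ]

module _ {n} (f : Var → Fin n) where

  update-agrees : ∀ ρ x {y} → y ≡ x ⊎ ρ y ≡ f y → (ρ [ x ↦ f x ]) y ≡ f y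
  update-agrees ρ x {y} h with y ℕ.≟ x | h
  ... | yes refl | _          = refl
  ... | no y≢x   | inj₁ y≡x   = ⊥-elim (y≢x y≡x)
  ... | no _     | inj₂ ρy≡fy = ρy≡fy

  updates-agree : ∀ ρ xs {y} → y ∈ xs ⊎ ρ y ≡ f y → (ρ [ xs ↦⋆ f ]) y ≡ f y
  updates-agree ρ []       (inj₂ ρy≡fy) = ρy≡fy
  updates-agree ρ (x ∷ xs) h = updates-agree (ρ [ x ↦ f x ]) xs (shift h)
    where
    shift : ∀ {y} → y ∈ x ∷ xs ⊎ ρ y ≡ f y → y ∈ xs ⊎ (ρ [ x ↦ f x ]) y ≡ f y
    shift (inj₁ (there y∈xs)) = inj₁ y∈xs
    shift (inj₁ (here y≡x))   = inj₂ (update-agrees ρ x (inj₁ y≡x))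
    shift (inj₂ ρy≡fy)        = inj₂ (update-agrees ρ x (inj₂ ρy≡fy))

adj⇒≢ : ∀ {n} (G : Graph n) {i j} → adj G i j ≡ true → i ≢ j
adj⇒≢ G {i} e refl with trans (≡.sym e) (irrefl G i)
... | ()

module _ {n} (G : Graph n) where

  sat? : ∀ ρ φ → Dec (Sat G ρ φ)
  sat? ρ (edge x y) = adj G (ρ x) (ρ y) Bool.≟ true
  sat? ρ (eq x y)   = ρ x Fin.≟ ρ y
  sat? ρ (φ ∧ ψ)    = sat? ρ φ ×-dec sat? ρ ψ
  sat? ρ (φ ∨ ψ)    = sat? ρ φ ⊎-dec sat? ρ ψ
  sat? ρ (∃′ x φ)   = Finₚ.any? (λ w → sat? (ρ [ x ↦ w ]) φ)

  module _ {ρ : Var → Fin n} where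

    sat-⋀⁺ : {A : Set} (xs : List A) {f : A → EPFormula} →
             (∀ {x} → x ∈ xs → Sat G ρ (f x)) → Sat G ρ (⋀ xs f)
    sat-⋀⁺ []       h = ρ 0 , refl
    sat-⋀⁺ (x ∷ xs) h = h (here refl) , sat-⋀⁺ xs (h ∘ there)

    sat-⋀⁻ : {A : Set} (xs : List A) {f : A → EPFormula} →
             Sat G ρ (⋀ xs f) → ∀ {x} → x ∈ xs → Sat G ρ (f x)
    sat-⋀⁻ (x ∷ xs) (s , _)  (here refl)  = s
    sat-⋀⁻ (x ∷ xs) (_ , ss) (there x∈xs) = sat-⋀⁻ xs ss x∈xs

    sat-edgeIf⁺ : ∀ b {x y} → (b ≡ true → adj G (ρ x) (ρ y) ≡ true) → Sat G ρ (edgeIf b x y)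
    sat-edgeIf⁺ true  h = h refl
    sat-edgeIf⁺ false h = ρ 0 , refl

    sat-edgeIf⁻ : ∀ b {x y} → Sat G ρ (edgeIf b x y) → b ≡ true → adj G (ρ x) (ρ y) ≡ true
    sat-edgeIf⁻ true s refl = s

  sat-∃⋆⁺ : ∀ xs ψ {ρ} (f : Var → Fin n) → Sat G (ρ [ xs ↦⋆ f ]) ψ → Sat G ρ (∃⋆ xs ψ)
  sat-∃⋆⁺ []       ψ f s = s
  sat-∃⋆⁺ (x ∷ xs) ψ f s = f x , sat-∃⋆⁺ xs ψ f s

  sat-∃⋆⁻ : ∀ xs ψ {ρ} → Sat G ρ (∃⋆ xs ψ) → Σ (Var → Fin n) λ σ → Sat G σ ψ
  sat-∃⋆⁻ []       ψ s       = _ , s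
  sat-∃⋆⁻ (x ∷ xs) ψ (_ , s) = sat-∃⋆⁻ xs ψ s

ProperOn : ∀ {n} → Graph n → List (Fin n) → (Fin n → Fin 3) → Set
ProperOn G L c = ∀ i j → i ∈ L → j ∈ L → adj G i j ≡ true → c i ≢ c j

ColourableOn : ∀ {n} → Graph n → List (Fin n) → Set
ColourableOn {n} G L = Σ (Fin n → Fin 3) (ProperOn G L)

-- Vertex i is named by the variable 1 + i; variable 0 is reserved for the
-- witness shared by all vertices of the largest colour class.
var : ∀ {n} → Fin n → Var
var i = suc (toℕ i)

vertexOf : ∀ {n} → Fin n → Var → Fin n
vertexOf {n} default (suc k) with k ℕ.<? n
... | yes k<n = fromℕ< k<n
... | no _    = default
vertexOf default zero = default

vertexOf-var : ∀ {n} (default i : Fin n) → vertexOf default (var i) ≡ i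
vertexOf-var {n} default i with toℕ i ℕ.<? n
... | yes i<n = Finₚ.fromℕ<-toℕ i i<n
... | no i≮n  = ⊥-elim (i≮n (Finₚ.toℕ<n i))

module Extension {n} (G : Graph n) (v : Fin n) (L : List (Fin n)) (c : Fin n → Fin 3) (b : Fin 3) where

  B S rest : List (Fin n)
  B    = filter (hasColour? c b) L
  rest = filter (¬? ∘ hasColour? c b) L
  S    = v ∷ rest

  diagram : EPFormula
  diagram = ⋀ S λ i → ⋀ S λ j → edgeIf (adj G i j) (var i) (var j)

  neighbourhood : Fin n → EPFormula
  neighbourhood u = ∃′ 0 (⋀ S λ j → edgeIf (adj G u j) 0 (var j))

  body φ : EPFormula
  body = diagram ∧ ⋀ B neighbourhood
  φ    = ∃⋆ (map var S) body

  var∈ : ∀ {i} → i ∈ S → var i ∈ map var S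
  var∈ = ∈-map⁺ var

  φ-sentence : IsSentence φ
  φ-sentence = All⊥⇒[] (fv-∃⋆ (map var S) body (All.map inj₁ fv-body))
    where
    fv-body : All (_∈ map var S) (fv body)
    fv-body = Allₚ.++⁺
      (fv-⋀ S λ i∈S → fv-⋀ S λ j∈S → fv-edgeIf (adj G _ _) (var∈ i∈S) (var∈ j∈S))
      (fv-⋀ B λ {u} _ → fv-∃′ 0 (⋀ S λ j → edgeIf (adj G u j) 0 (var j))
        (fv-⋀ S λ j∈S → fv-edgeIf (adj G _ _) (inj₁ refl) (inj₂ (var∈ j∈S))))

  φ-width : width φ ≤ 2 + length rest
  φ-width = subst (width φ ≤_) (cong suc (Listₚ.length-map var S))
    (width≤length φ {0 ∷ map var S} (vars-∃⋆ (map var S) body (All.tabulate there) vars-body))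
    where
    vars-body : All (_∈ 0 ∷ map var S) (vars body)
    vars-body = Allₚ.++⁺
      (vars-⋀ (here refl) S λ i∈S → vars-⋀ (here refl) S λ j∈S →
        vars-edgeIf (here refl) (adj G _ _) (there (var∈ i∈S)) (there (var∈ j∈S)))
      (vars-⋀ (here refl) B λ _ → here refl ∷ vars-⋀ (here refl) S λ j∈S →
        vars-edgeIf (here refl) (adj G _ _) (here refl) (there (var∈ j∈S)))

  G⊨φ : G ⊨ φ
  G⊨φ ρ = sat-∃⋆⁺ G (map var S) body (vertexOf v) sat-body
    where
    σ : Var → Fin n
    σ = ρ [ map var S ↦⋆ vertexOf v ]
    named : ∀ {i} → i ∈ S → σ (var i) ≡ i
    named {i} i∈S = trans (updates-agree (vertexOf v) ρ (map var S) (inj₁ (var∈ i∈S))) (vertexOf-var v i)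
    sat-body : Sat G σ body
    sat-body =
      sat-⋀⁺ G S (λ i∈S → sat-⋀⁺ G S λ j∈S → sat-edgeIf⁺ G (adj G _ _) λ e →
        subst₂ (λ x y → adj G x y ≡ true) (≡.sym (named i∈S)) (≡.sym (named j∈S)) e) ,
      sat-⋀⁺ G B λ {u} _ → u , sat-⋀⁺ G S λ j∈S → sat-edgeIf⁺ G (adj G _ _) λ e →
        subst (λ y → adj G u y ≡ true) (≡.sym (named j∈S)) e

  outside-S⇒∈B : ∀ {i} → i ∈ v ∷ L → i ∉ S → i ∈ B
  outside-S⇒∈B (here refl) i∉S = ⊥-elim (i∉S (here refl))
  outside-S⇒∈B {i} (there i∈L) i∉S with hasColour? c b i
  ... | yes ci≡b = ∈-filter⁺ (hasColour? c b) i∈L ci≡b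
  ... | no ci≢b  = ⊥-elim (i∉S (there (∈-filter⁺ (¬? ∘ hasColour? c b) i∈L ci≢b)))

  module FromK3 {σ : Var → Fin 3} (s : Sat K3 σ body) where

    open DecMembership (Fin._≟_ {n}) using (_∈?_)

    witness : ∀ {u} → u ∈ B → Σ (Fin 3) λ w → Sat K3 (σ [ 0 ↦ w ]) (⋀ S λ j → edgeIf (adj G u j) 0 (var j))
    witness = sat-⋀⁻ K3 B (proj₂ s)

    colourOf : ∀ i → Dec (i ∈ S) → Dec (i ∈ B) → Fin 3
    colourOf i (yes _) _        = σ (var i)
    colourOf i (no _)  (yes i∈B) = proj₁ (witness i∈B)
    colourOf i (no _)  (no _)    = 0F

    colour : Fin n → Fin 3
    colour i = colourOf i (i ∈? S) (i ∈? B)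

    outsider≢ : ∀ {i j} → i ∈ S → (j∉S : j ∉ S) (eⱼ : Dec (j ∈ B)) → j ∈ v ∷ L → adj G j i ≡ true →
                colourOf j (no j∉S) eⱼ ≢ σ (var i)
    outsider≢ i∈S j∉S (yes j∈B) _ a =
      adj⇒≢ K3 (sat-edgeIf⁻ K3 (adj G _ _) (sat-⋀⁻ K3 S (proj₂ (witness j∈B)) i∈S) a)
    outsider≢ i∈S j∉S (no j∉B) j∈vL _ = ⊥-elim (j∉B (outside-S⇒∈B j∈vL j∉S))

    colourOf-proper : ProperOn G L c →
                      ∀ i j (dᵢ : Dec (i ∈ S)) (dⱼ : Dec (j ∈ S)) (eᵢ : Dec (i ∈ B)) (eⱼ : Dec (j ∈ B)) →
                      i ∈ v ∷ L → j ∈ v ∷ L → adj G i j ≡ true → colourOf i dᵢ eᵢ ≢ colourOf j dⱼ eⱼ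
    colourOf-proper _ i j (yes i∈S) (yes j∈S) _ _ _ _ a =
      adj⇒≢ K3 (sat-edgeIf⁻ K3 (adj G i j) (sat-⋀⁻ K3 S (sat-⋀⁻ K3 S (proj₁ s) i∈S) j∈S) a)
    colourOf-proper _ i j (yes i∈S) (no j∉S) _ eⱼ _ j∈vL a =
      outsider≢ i∈S j∉S eⱼ j∈vL (trans (Graph.sym G j i) a) ∘ ≡.sym
    colourOf-proper _ i j (no i∉S) (yes j∈S) eᵢ _ i∈vL _ a = outsider≢ j∈S i∉S eᵢ i∈vL a
    colourOf-proper cL i j (no i∉S) (no j∉S) _ _ i∈vL j∈vL a _ = cL i j (proj₁ i∈L,ci≡b) (proj₁ j∈L,cj≡b) a
      (trans (proj₂ i∈L,ci≡b) (≡.sym (proj₂ j∈L,cj≡b)))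
      where
      i∈L,ci≡b : i ∈ L × c i ≡ b
      i∈L,ci≡b = ∈-filter⁻ (hasColour? c b) (outside-S⇒∈B i∈vL i∉S)
      j∈L,cj≡b : j ∈ L × c j ≡ b
      j∈L,cj≡b = ∈-filter⁻ (hasColour? c b) (outside-S⇒∈B j∈vL j∉S)

    colour-proper : ProperOn G L c → ProperOn G (v ∷ L) colour
    colour-proper cL i j = colourOf-proper cL i j (i ∈? S) (j ∈? S) (i ∈? B) (j ∈? B)

  extend-or-separate : ProperOn G L c → ColourableOn G (v ∷ L) ⊎ ¬ (K3 ⊨ φ)
  extend-or-separate cL with sat? K3 (λ _ → 0F) φ
  ... | no K3⊭φ  = inj₂ λ K3⊨φ → K3⊭φ (K3⊨φ _)
  ... | yes K3⊨φ with sat-∃⋆⁻ K3 (map var S) body K3⊨φ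
  ...   | _ , s = inj₁ (FromK3.colour s , FromK3.colour-proper s cL)

Separated : ∀ {n} → Graph n → Set
Separated {n} G = Σ ℕ λ k → (4 * k ≤ 3 * n + 4) × W≤ G k

module _ {n} (G : Graph n) (4≤n : 4 ≤ n) where

  colourable-or-separated : ∀ L → length L ≤ n → ColourableOn G L ⊎ Separated G
  colourable-or-separated []      _   = inj₁ ((λ _ → 0F) , λ _ _ ())
  colourable-or-separated (v ∷ L) L<n = [ extend , inj₂ ] (colourable-or-separated L (ℕₚ.<⇒≤ L<n))
    where
    extend : ColourableOn G L → ColourableOn G (v ∷ L) ⊎ Separated G
    extend (c , c-proper) = Sum.map₂ separated (extend-or-separate c-proper)
      where
      b : Fin 3
      b = proj₁ (largest-class c L)
      open Extension G v L c b
      B+rest<n : length B + length rest < n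
      B+rest<n = subst (_< n) (≡.sym (length-filter-split (hasColour? c b) L)) L<n
      separated : ¬ (K3 ⊨ φ) → Separated G
      separated K3⊭φ = 2 + length rest , width-budget (proj₂ (largest-class c L)) B+rest<n 4≤n ,
                       φ , φ-sentence , φ-width , G⊨φ , K3⊭φ

corollary1 : (n : ℕ) → 4 ≤ n → (G : Graph n) → (χ> 3) G →
    Σ ℕ λ k → (4 * k ≤ 3 * n + 4) × W≤ G k
corollary1 n 4≤n G χ>3 with colourable-or-separated G 4≤n (allFin n) (ℕₚ.≤-reflexive (Listₚ.length-tabulate (λ i → i)))
... | inj₁ (c , c-proper) = ⊥-elim (χ>3 (c , λ i j → c-proper i j (∈-allFin i) (∈-allFin j)))
... | inj₂ separated      = separated
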